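{- The linear map $\Phi:\mathcal H_{\mathbb Z\times\mathbb Z_{\ge1}}\to\mathcal H_{\mathbb Z}$ defined by $\Phi(\mathbf 1)=\mathbf 1$ and $\Phi\binom{\vec s}{\vec u}=[\vec s]$ is an algebra homomorphism. That is, $\Phi(a\sqcup\!\sqcup b)=\Phi(a)\sqcup\!\sqcup\Phi(b)$ for all $a,b\in\mathcal H_{\mathbb Z\times\mathbb Z_{\ge1}}$, where the product on the left is the two-row product and the product on the right is the extended shuffle product.
   Context: One-row algebra. Let $\mathcal H_{\mathbb Z}$ be the $\mathbb Q$-vector space with basis $\mathbf 1$ together with the formal symbols $[s_1,\dots,s_k]$ ($k\ge1$, $s_i\in\mathbb Z$). Let $I[s_1,\dots,s_k]=[s_1+1,s_2,\dots,s_k]$ and $J[s_1,\dots,s_k]=[s_1-1,s_2,\dots,s_k]$, with $J(\mathbf 1)=0$. Write $[s_1,\dots,s_k]=[s_1,\vec s\,']$, where $[\vec s\,']$ is $[s_2,\dots,s_k]$, or $\mathbf 1$ if $k=1$. For $a\in\mathbb Z$ and $X=\sum c[\vec v]$, put $[a,X]:=\sum c[a,\vec v]$, with $[a,\mathbf 1]=[a]$. The extended shuffle product $\sqcup\!\sqcup$ on $\mathcal H_{\mathbb Z}$ is bilinear with unit $\mathbf 1$, and is defined on positive-depth basis elements by: <ul> <li>(i) if $s_1=0$: $[0,\vec s\,']\sqcup\!\sqcup[t_1,\vec t\,']=[0,[\vec s\,']\sqcup\!\sqcup[t_1,\vec t\,']]$;</li> <li>(ii) if $s_1>0$ and $t_1=0$: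 $[s_1,\vec s\,']\sqcup\!\sqcup[0,\vec t\,']=[0,[s_1,\vec s\,']\sqcup\!\sqcup[\vec t\,']]$;</li> <li>(iii) if $s_1,t_1>0$: the product equals $I([s_1,\vec s\,']\sqcup\!\sqcup[t_1-1,\vec t\,'])+I([s_1-1,\vec s\,']\sqcup\!\sqcup[t_1,\vec t\,'])$;</li> <li>(iv) if $s_1>0$ and $t_1<0$: the product equals $J([s_1,\vec s\,']\sqcup\!\sqcup[t_1+1,\vec t\,'])-[s_1-1,\vec s\,']\sqcup\!\sqcup[t_1+1,\vec t\,']$;</li> <li>(v) if $s_1<0$: the product equals $J([s_1+1,\vec s\,']\sqcup\!\sqcup[t_1,\vec t\,'])-[s_1+1,\vec s\,']\sqcup\!\sqcup[t_1-1,\vec t\,']$.</li> </ul> Two-row algebra. Let $\mathcal H_{\mathbb Z\times\mathbb Z_{\ge1}}$ have basis $\mathbf 1$ together with the formal symbols $\binom{\vec s}{\vec u}=\binom{s_1,\dots,s_k}{u_1,\dots,u_k}$ ($k\ge1$, $\vec s\in\mathbb Z^k$, $\vec u\in\mathbb Z_{\ge1}^k$). $I^S$ and $J^S$ add $+1$ and $-1$ respectively to the top-left entry, with $J^S(\mathbf 1)=0$. Its product $\sqcup\!\sqcup$ is defined by the same five recursions, with bottom entries carried along: <ul> <li>(i) if $s_1=0$, the column $\binom{0}{u_1}$ is prepended to $\binom{\vec s\,'}{\vec u'}\sqcup\!\sqcup\binom{t_1,\vec t\,'}{v_1,\vec v'}$;</li> <li>(ii) if $s_1>0$ and $t_1=0$,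 the column $\binom{0}{v_1}$ is prepended to $\binom{s_1,\vec s\,'}{u_1,\vec u'}\sqcup\!\sqcup\binom{\vec t\,'}{\vec v'}$;</li> <li>(iii)–(v) are as in the one-row case with $I^S,J^S$ in place of $I,J$. Only the top entries $s_1,t_1$ are shifted, and the bottom rows $u_1,\vec u'$ and $v_1,\vec v'$ are unchanged.</li> </ul> -}

module Defs where

open import Data.Nat using (ℕ; zero; suc; _≤_)
open import Data.Integer using (ℤ; +_; -[1+_]; _-_; 1ℤ; 0ℤ)
import Data.Integer.Properties as ℤP
open import Data.Rational using (ℚ; 1ℚ; 0ℚ) renaming (_*_ to _*ℚ_; -_ to -ℚ_; _+_ to _+ℚ_)
open import Data.List using (List; []; _∷_; _++_; map; concatMap)
import Data.List.Properties as LP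
open import Data.Product using (_×_; _,_; proj₁; Σ-syntax)
open import Relation.Binary.PropositionalEquality using (_≡_)
open import Relation.Nullary using (yes; no)

-- A vector is a finite formal sum  Σ c · w, stored as a list of
-- (coefficient , basis word) pairs.  The basis element 1 is the empty word.
LinComb : Set → Set
LinComb W = List (ℚ × W)

module _ {W : Set} where
  single : W → LinComb W
  single w = (1ℚ , w) ∷ []

  _⊕_ : LinComb W → LinComb W → LinComb W
  _⊕_ = _++_

  scale : ℚ → LinComb W → LinComb W
  scale c = map (λ { (d , w) → (c *ℚ d , w) })

  _⊖_ : LinComb W → LinComb W → LinComb W
  x ⊖ y = x ⊕ scale (-ℚ 1ℚ) y

Word₁ : Set
Word₁ = List ℤ

H₁ : Set
H₁ = LinComb Word₁

coeff₁ : H₁ → Word₁ → ℚ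
coeff₁ [] w = 0ℚ
coeff₁ ((c , v) ∷ x) w with LP.≡-dec ℤP._≟_ v w
... | yes _ = c +ℚ coeff₁ x w
... | no  _ = coeff₁ x w

_≈₁_ : H₁ → H₁ → Set
x ≈₁ y = ∀ w → coeff₁ x w ≡ coeff₁ y w

pre₁ : ℤ → H₁ → H₁
pre₁ a = map (λ { (c , w) → (c , a ∷ w) })

-- I and J (I is only ever applied to positive-depth words; on 1 we set both to 0)
I₁ J₁ : H₁ → H₁
I₁ [] = []
I₁ ((c , []) ∷ x) = I₁ x
I₁ ((c , s ∷ w) ∷ x) = (c , (s Data.Integer.+ 1ℤ) ∷ w) ∷ I₁ x
J₁ [] = []
J₁ ((c , []) ∷ x) = J₁ x
J₁ ((c , s ∷ w) ∷ x) = (c , (s - 1ℤ) ∷ w) ∷ J₁ x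

-- Extended shuffle product on basis words.
--   pair₁ x s' y t'   = [x , s'] ⧢ [y , t']
--   pairP₁ k s' y t'  = [+k , s'] ⧢ [y , t']
--   pairN₁ m s' y t'  = [-(m+1) , s'] ⧢ [y , t']
--   zeroR₁ k s' t'    = [+k , s'] ⧢ [0 , t']
-- Each clause is one of the rules (i)-(v) (rules (ii)/(iv) with t₁+1 = 0
-- are routed through zeroR₁, which is just the product with t₁ = 0).
mutual
  pair₁ : ℤ → Word₁ → ℤ → Word₁ → H₁
  pair₁ (+ k) s' y t' = pairP₁ k s' y t'
  pair₁ -[1+ m ] s' y t' = pairN₁ m s' y t'

  zeroR₁ : ℕ → Word₁ → Word₁ → H₁
  zeroR₁ zero [] t' = pre₁ 0ℤ (single (0ℤ ∷ t'))
  zeroR₁ zero (x ∷ s'') t' = pre₁ 0ℤ (pair₁ x s'' 0ℤ t')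
  zeroR₁ (suc m) s' [] = pre₁ 0ℤ (single (+ suc m ∷ s'))
  zeroR₁ (suc m) s' (y ∷ t'') = pre₁ 0ℤ (pair₁ (+ suc m) s' y t'')

  pairP₁ : ℕ → Word₁ → ℤ → Word₁ → H₁
  pairP₁ zero [] y t' = pre₁ 0ℤ (single (y ∷ t'))
  pairP₁ zero (x ∷ s'') y t' = pre₁ 0ℤ (pair₁ x s'' y t')
  pairP₁ (suc m) s' (+ zero) t' = zeroR₁ (suc m) s' t'
  pairP₁ (suc m) s' (+ suc n) t' =
    I₁ (pairP₁ (suc m) s' (+ n) t') ⊕ I₁ (pairP₁ m s' (+ suc n) t')
  pairP₁ (suc m) s' -[1+ zero ] t' =
    J₁ (zeroR₁ (suc m) s' t') ⊖ zeroR₁ m s' t'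
  pairP₁ (suc m) s' -[1+ suc n ] t' =
    J₁ (pairP₁ (suc m) s' -[1+ n ] t') ⊖ pairP₁ m s' -[1+ n ] t'

  pairN₁ : ℕ → Word₁ → ℤ → Word₁ → H₁
  pairN₁ zero s' y t' = J₁ (pairP₁ zero s' y t') ⊖ pairP₁ zero s' (y - 1ℤ) t'
  pairN₁ (suc m) s' y t' = J₁ (pairN₁ m s' y t') ⊖ pairN₁ m s' (y - 1ℤ) t'

mulW₁ : Word₁ → Word₁ → H₁
mulW₁ [] t = single t
mulW₁ (x ∷ s) [] = single (x ∷ s)
mulW₁ (x ∷ s) (y ∷ t) = pair₁ x s y t

_⧢₁_ : H₁ → H₁ → H₁
a ⧢₁ b = concatMap (λ { (c , w) → concatMap (λ { (d , v) → scale (c *ℚ d) (mulW₁ w v) }) b }) a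

ℕ≥1 : Set
ℕ≥1 = Σ[ u ∈ ℕ ] 1 ≤ u

Col : Set
Col = ℤ × ℕ≥1

Word₂ : Set
Word₂ = List Col

H₂ : Set
H₂ = LinComb Word₂

pre₂ : Col → H₂ → H₂
pre₂ a = map (λ { (c , w) → (c , a ∷ w) })

I₂ J₂ : H₂ → H₂
I₂ [] = []
I₂ ((c , []) ∷ x) = I₂ x
I₂ ((c , (s , u) ∷ w) ∷ x) = (c , (s Data.Integer.+ 1ℤ , u) ∷ w) ∷ I₂ x
J₂ [] = []
J₂ ((c , []) ∷ x) = J₂ x
J₂ ((c , (s , u) ∷ w) ∷ x) = (c , (s - 1ℤ , u) ∷ w) ∷ J₂ x

--   pair₂ x u s' y v t'  = (x s' ; u u') ⧢ (y t' ; v v')  (columns split)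
mutual
  pair₂ : ℤ → ℕ≥1 → Word₂ → ℤ → ℕ≥1 → Word₂ → H₂
  pair₂ (+ k) u s' y v t' = pairP₂ k u s' y v t'
  pair₂ -[1+ m ] u s' y v t' = pairN₂ m u s' y v t'

  -- first top entry +k (k ≥ 0), second top entry 0
  zeroR₂ : ℕ → ℕ≥1 → Word₂ → ℕ≥1 → Word₂ → H₂
  zeroR₂ zero u [] v t' = pre₂ (0ℤ , u) (single ((0ℤ , v) ∷ t'))
  zeroR₂ zero u ((x , u₂) ∷ s'') v t' = pre₂ (0ℤ , u) (pair₂ x u₂ s'' 0ℤ v t')
  zeroR₂ (suc m) u s' v [] = pre₂ (0ℤ , v) (single ((+ suc m , u) ∷ s'))
  zeroR₂ (suc m) u s' v ((y , v₂) ∷ t'') = pre₂ (0ℤ , v) (pair₂ (+ suc m) u s' y v₂ t'')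

  pairP₂ : ℕ → ℕ≥1 → Word₂ → ℤ → ℕ≥1 → Word₂ → H₂
  pairP₂ zero u [] y v t' = pre₂ (0ℤ , u) (single ((y , v) ∷ t'))
  pairP₂ zero u ((x , u₂) ∷ s'') y v t' = pre₂ (0ℤ , u) (pair₂ x u₂ s'' y v t')
  pairP₂ (suc m) u s' (+ zero) v t' = zeroR₂ (suc m) u s' v t'
  pairP₂ (suc m) u s' (+ suc n) v t' =
    I₂ (pairP₂ (suc m) u s' (+ n) v t') ⊕ I₂ (pairP₂ m u s' (+ suc n) v t')
  pairP₂ (suc m) u s' -[1+ zero ] v t' =
    J₂ (zeroR₂ (suc m) u s' v t') ⊖ zeroR₂ m u s' v t'
  pairP₂ (suc m) u s' -[1+ suc n ] v t' =
    J₂ (pairP₂ (suc m) u s' -[1+ n ] v t') ⊖ pairP₂ m u s' -[1+ n ] v t'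

  pairN₂ : ℕ → ℕ≥1 → Word₂ → ℤ → ℕ≥1 → Word₂ → H₂
  pairN₂ zero u s' y v t' = J₂ (pairP₂ zero u s' y v t') ⊖ pairP₂ zero u s' (y - 1ℤ) v t'
  pairN₂ (suc m) u s' y v t' = J₂ (pairN₂ m u s' y v t') ⊖ pairN₂ m u s' (y - 1ℤ) v t'

mulW₂ : Word₂ → Word₂ → H₂
mulW₂ [] t = single t
mulW₂ (c ∷ s) [] = single (c ∷ s)
mulW₂ ((x , u) ∷ s) ((y , v) ∷ t) = pair₂ x u s y v t

_⧢₂_ : H₂ → H₂ → H₂
a ⧢₂ b = concatMap (λ { (c , w) → concatMap (λ { (d , v) → scale (c *ℚ d) (mulW₂ w v) }) b }) a

Φ : H₂ → H₁
Φ = map (λ { (c , w) → (c , map proj₁ w) })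

{-# OPTIONS --safe #-}
module Submission where

-- Φ forgets the bottom row, and the bottom entries never decide which of
-- the rules (i)–(v) applies.  Φ commutes with prepending a column, with I
-- and J (they touch only the top row) and with sums and scalar multiples, so
-- an induction following the mutual recursion that defines the two-row
-- product of words shows that Φ maps it to the one-row product of the top
-- rows, literally as lists.  Bilinearity of both products does the rest.

open import Defs
open import Data.Integer using (+_; -[1+_]; _-_; 1ℤ; 0ℤ)
open import Data.List using ([]; _∷_; map; concatMap)
open import Data.List.Properties using (map-++; map-∘; map-concatMap; concatMap-map; concatMap-cong)
open import Data.Nat using (zero; suc)
open import Data.Product using (_×_; _,_; proj₁; map₂)
open import Data.Rational using (ℚ; _*_; -_; 1ℚ)
open import Function using (_∘_)
open import Relation.Binary.PropositionalEquality
  using (_≡_; refl; sym; trans; cong; cong₂; module ≡-Reasoning)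

topRow : Word₂ → Word₁
topRow = map proj₁

Φ-⊕ : ∀ x y → Φ (x ⊕ y) ≡ Φ x ⊕ Φ y
Φ-⊕ = map-++ _

-- Here and in Φ-pre both sides are `map` of one composite function, by η for pairs.
Φ-scale : ∀ c x → Φ (scale c x) ≡ scale c (Φ x)
Φ-scale c x = trans (sym (map-∘ x)) (map-∘ x)

Φ-pre : ∀ a u x → Φ (pre₂ (a , u) x) ≡ pre₁ a (Φ x)
Φ-pre a u x = trans (sym (map-∘ x)) (map-∘ x)

Φ-⊖ : ∀ x y → Φ (x ⊖ y) ≡ Φ x ⊖ Φ y
Φ-⊖ x y = trans (Φ-⊕ x _) (cong (Φ x ⊕_) (Φ-scale (- 1ℚ) y))

Φ-I : ∀ x → Φ (I₂ x) ≡ I₁ (Φ x)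
Φ-I [] = refl
Φ-I ((c , []) ∷ x) = Φ-I x
Φ-I ((c , (s , u) ∷ w) ∷ x) = cong (_ ∷_) (Φ-I x)

Φ-J : ∀ x → Φ (J₂ x) ≡ J₁ (Φ x)
Φ-J [] = refl
Φ-J ((c , []) ∷ x) = Φ-J x
Φ-J ((c , (s , u) ∷ w) ∷ x) = cong (_ ∷_) (Φ-J x)

Φ-I⊕I : ∀ {x y x′ y′} → Φ x ≡ x′ → Φ y ≡ y′ → Φ (I₂ x ⊕ I₂ y) ≡ I₁ x′ ⊕ I₁ y′
Φ-I⊕I {x} {y} refl refl = trans (Φ-⊕ (I₂ x) (I₂ y)) (cong₂ _⊕_ (Φ-I x) (Φ-I y))

Φ-J⊖ : ∀ {x y x′ y′} → Φ x ≡ x′ → Φ y ≡ y′ → Φ (J₂ x ⊖ y) ≡ J₁ x′ ⊖ y′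
Φ-J⊖ {x} {y} refl refl = trans (Φ-⊖ (J₂ x) y) (cong (_⊖ Φ y) (Φ-J x))

mutual
  Φ-pair : ∀ x u s y v t → Φ (pair₂ x u s y v t) ≡ pair₁ x (topRow s) y (topRow t)
  Φ-pair (+ k)    u s y v t = Φ-pairP k u s y v t
  Φ-pair -[1+ m ] u s y v t = Φ-pairN m u s y v t

  Φ-zeroR : ∀ k u s v t → Φ (zeroR₂ k u s v t) ≡ zeroR₁ k (topRow s) (topRow t)
  Φ-zeroR zero    u []              v t               = refl
  Φ-zeroR zero    u ((x , u₂) ∷ s′) v t               =
    trans (Φ-pre 0ℤ u _) (cong (pre₁ 0ℤ) (Φ-pair x u₂ s′ 0ℤ v t))
  Φ-zeroR (suc m) u s               v []              = refl
  Φ-zeroR (suc m) u s               v ((y , v₂) ∷ t′) =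
    trans (Φ-pre 0ℤ v _) (cong (pre₁ 0ℤ) (Φ-pair (+ suc m) u s y v₂ t′))

  Φ-pairP : ∀ k u s y v t → Φ (pairP₂ k u s y v t) ≡ pairP₁ k (topRow s) y (topRow t)
  Φ-pairP zero    u []              y v t = refl
  Φ-pairP zero    u ((x , u₂) ∷ s′) y v t =
    trans (Φ-pre 0ℤ u _) (cong (pre₁ 0ℤ) (Φ-pair x u₂ s′ y v t))
  Φ-pairP (suc m) u s (+ zero)    v t = Φ-zeroR (suc m) u s v t
  Φ-pairP (suc m) u s (+ suc n)   v t =
    Φ-I⊕I (Φ-pairP (suc m) u s (+ n) v t) (Φ-pairP m u s (+ suc n) v t)
  Φ-pairP (suc m) u s -[1+ zero ]  v t =
    Φ-J⊖ (Φ-zeroR (suc m) u s v t) (Φ-zeroR m u s v t)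
  Φ-pairP (suc m) u s -[1+ suc n ] v t =
    Φ-J⊖ (Φ-pairP (suc m) u s -[1+ n ] v t) (Φ-pairP m u s -[1+ n ] v t)

  Φ-pairN : ∀ m u s y v t → Φ (pairN₂ m u s y v t) ≡ pairN₁ m (topRow s) y (topRow t)
  Φ-pairN zero    u s y v t = Φ-J⊖ (Φ-pairP zero u s y v t) (Φ-pairP zero u s (y - 1ℤ) v t)
  Φ-pairN (suc m) u s y v t = Φ-J⊖ (Φ-pairN m u s y v t) (Φ-pairN m u s (y - 1ℤ) v t)

Φ-mulW : ∀ w v → Φ (mulW₂ w v) ≡ mulW₁ (topRow w) (topRow v)
Φ-mulW []            t             = refl
Φ-mulW (c ∷ s)       []            = refl
Φ-mulW ((x , u) ∷ s) ((y , v) ∷ t) = Φ-pair x u s y v t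

Φ-concatMap : ∀ {F : ℚ × Word₂ → H₂} {G : ℚ × Word₁ → H₁} a →
              (∀ c w → Φ (F (c , w)) ≡ G (c , topRow w)) →
              Φ (concatMap F a) ≡ concatMap G (Φ a)
Φ-concatMap {F} {G} a hom = begin
  Φ (concatMap F a)             ≡⟨ map-concatMap _ F a ⟩
  concatMap (Φ ∘ F) a           ≡⟨ concatMap-cong (λ { (c , w) → hom c w }) a ⟩
  concatMap (G ∘ map₂ topRow) a ≡⟨ concatMap-map G (map₂ topRow) a ⟨
  concatMap G (Φ a)             ∎
  where open ≡-Reasoning

Φ-⧢ : ∀ a b → Φ (a ⧢₂ b) ≡ Φ a ⧢₁ Φ b
Φ-⧢ a b = Φ-concatMap a (λ c w → Φ-concatMap b (λ d v → Φ-scale-mulW c d w v))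
  where
  Φ-scale-mulW : ∀ c d w v →
                 Φ (scale (c * d) (mulW₂ w v)) ≡ scale (c * d) (mulW₁ (topRow w) (topRow v))
  Φ-scale-mulW c d w v = trans (Φ-scale (c * d) (mulW₂ w v)) (cong (scale (c * d)) (Φ-mulW w v))

proposition3p9 : (a b : H₂) → Φ (a ⧢₂ b) ≈₁ (Φ a ⧢₁ Φ b)
proposition3p9 a b w = cong (λ x → coeff₁ x w) (Φ-⧢ a b)
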